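{- Let $G$ be a finite simple connected graph on $n$ vertices and let $\alpha\in[0,1)$ be rational. Then the rank of $\tilde W_\alpha(G)$ over $\mathbb F_2$ is at most $\lceil n/2\rceil$.
   Context: For a graph $G$ on $n$ vertices, $A(G)$ is its adjacency matrix, $D(G)$ its diagonal degree matrix, $A_\alpha(G)=\alpha D(G)+(1-\alpha)A(G)$. For rational $\alpha\in[0,1)$, $c_\alpha$ is the smallest positive integer such that $c_\alpha\alpha$ and $c_\alpha(1-\alpha)$ are integers, and $A_{c_\alpha}(G)=c_\alpha A_\alpha(G)$. $\mathbf 1$ is the all-ones vector and $\tilde W_\alpha(G)=\left[\mathbf 1,\frac{A_{c_\alpha}(G)\mathbf 1}{c_\alpha},\dots,\frac{A_{c_\alpha}(G)^{n-1}\mathbf 1}{c_\alpha}\right]$ (an integral matrix). -}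

module Defs where

open import Data.Nat as ℕ using (ℕ; zero; suc)
open import Data.Integer as ℤ using (ℤ; +_)
open import Data.Integer.DivMod using () renaming (_/_ to _divℤ_)
open import Data.Fin using (Fin; zero; suc; toℕ; _≟_)
open import Data.Bool using (Bool; true; false; if_then_else_; _xor_; _∧_)
open import Data.List using (List; []; _∷_)
open import Data.Product using (Σ; ∃; _×_; _,_)
open import Data.Rational using (ℚ; ↥_; ↧_)
open import Relation.Nullary using (¬_; does)
open import Relation.Binary.PropositionalEquality using (_≡_)

record SimpleGraph (n : ℕ) : Set where
  field
    adj       : Fin n → Fin n → Bool
    symmetric : ∀ i j → adj i j ≡ adj j i
    loopless  : ∀ i → adj i i ≡ false

open SimpleGraph public

IsWalk : ∀ {n} → SimpleGraph n → Fin n → List (Fin n) → Fin n → Set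
IsWalk G u []       v = u ≡ v
IsWalk G u (w ∷ ws) v = (adj G u w ≡ true) × IsWalk G w ws v

Connected : ∀ {n} → SimpleGraph n → Set
Connected {n} G = ∀ (u v : Fin n) → ∃ λ ws → IsWalk G u ws v

Vecℤ : ℕ → Set
Vecℤ n = Fin n → ℤ

Matℤ : ℕ → ℕ → Set
Matℤ m k = Fin m → Fin k → ℤ

sumℤ : ∀ {n} → (Fin n → ℤ) → ℤ
sumℤ {zero}  f = + 0
sumℤ {suc n} f = f zero ℤ.+ sumℤ (λ i → f (suc i))

_·ᵥ_ : ∀ {n} → Matℤ n n → Vecℤ n → Vecℤ n
(M ·ᵥ v) i = sumℤ (λ j → M i j ℤ.* v j)

_·ₘ_ : ∀ {n} → Matℤ n n → Matℤ n n → Matℤ n n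
(M ·ₘ N) i j = sumℤ (λ k → M i k ℤ.* N k j)

idMat : ∀ {n} → Matℤ n n
idMat i j = if does (i ≟ j) then + 1 else + 0

_^ₘ_ : ∀ {n} → Matℤ n n → ℕ → Matℤ n n
M ^ₘ zero  = idMat
M ^ₘ suc k = M ·ₘ (M ^ₘ k)

𝟏 : ∀ {n} → Vecℤ n
𝟏 _ = + 1

boolℤ : Bool → ℤ
boolℤ true  = + 1
boolℤ false = + 0

adjMat : ∀ {n} → SimpleGraph n → Matℤ n n
adjMat G i j = boolℤ (adj G i j)

degree : ∀ {n} → SimpleGraph n → Fin n → ℤ
degree G i = sumℤ (λ j → boolℤ (adj G i j))

degMat : ∀ {n} → SimpleGraph n → Matℤ n n
degMat G i j = if does (i ≟ j) then degree G i else + 0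

-- c_α : for α = p/q in lowest terms (q > 0), the least positive integer c with
-- cα, c(1-α) integral is q, the (normalised) denominator.
cα : ℚ → ℤ
cα α = ↧ α

-- A_{c_α}(G) = c_α α D(G) + c_α (1-α) A(G) = p D(G) + (q - p) A(G)
Acα : ∀ {n} → ℚ → SimpleGraph n → Matℤ n n
Acα α G i j = (↥ α) ℤ.* degMat G i j ℤ.+ (cα α ℤ.- ↥ α) ℤ.* adjMat G i j

-- W̃_α(G) : column 0 is 𝟏, column k ≥ 1 is A_{c_α}(G)^k 𝟏 / c_α
-- (exact integer division; the paper notes the result is integral).
W̃ : ∀ {n} → ℚ → SimpleGraph n → Matℤ n n
W̃ α G i k with toℕ k
... | zero  = + 1
... | suc m = (((Acα α G ^ₘ suc m) ·ᵥ 𝟏) i) divℤ (cα α)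

mod2 : ℤ → Bool
mod2 x = does (ℕ._≟_ (ℕ._%_ ℤ.∣ x ∣ 2) 1)

xorSum : ∀ {m} → (Fin m → Bool) → Bool
xorSum {zero}  f = false
xorSum {suc m} f = f zero xor xorSum (λ j → f (suc j))

LinIndepF2 : ∀ {n m} → (Fin m → Fin n → Bool) → Set
LinIndepF2 {n} {m} v =
  ∀ (c : Fin m → Bool) →
  (∀ (i : Fin n) → xorSum (λ j → c j ∧ v j i) ≡ false) →
  ∀ (j : Fin m) → c j ≡ false

-- rank over 𝔽₂ of an integer matrix (n rows, k columns) is at most r:
-- the rank is the maximal number of 𝔽₂-linearly independent columns, so
-- every linearly independent family of columns has at most r members.
RankF2≤ : ∀ {n k} → Matℤ n k → ℕ → Set
RankF2≤ {n} {k} M r =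
  ∀ (m : ℕ) (s : Fin m → Fin k) →
  LinIndepF2 (λ j i → mod2 (M i (s j))) → m ℕ.≤ r

-- Reduce modulo 2. Column 0 of W̃ becomes 𝟙 and column k + 1 becomes T^k d, where T is
-- A_{c_α}(G) mod 2, a symmetric matrix, and d is the degree vector mod 2. Over 𝔽₂ the
-- quadratic form x·Tx of a symmetric matrix is the linear form diag(T)·x, and here
-- diag(T) = p d (p the numerator of α, mod 2), T𝟙 = c_α d, and 𝟙·d = 0 by the handshake lemma.
-- A strong induction on a + b then gives T^a d · T^b d = 0 and 𝟙 · T^k d = 0. So among m
-- independent columns all but possibly 𝟙 are orthogonal to all of them, and since mutually
-- orthogonal independent families in 𝔽₂ⁿ have total size at most n, m + (m - 1) ≤ n.
module Submission where

open import Defs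

module LinearAlgebraOver𝔽₂ where

  open import Algebra.Bundles using (Monoid; CommutativeRing)
  import Algebra.Properties.CommutativeSemigroup as CommutativeSemigroupProperties
  import Algebra.Properties.Monoid.Sum as MonoidSum
  import Algebra.Properties.Semiring.Sum as SemiringSum
  open import Data.Bool using (Bool; true; false; if_then_else_; _xor_; _∧_)
  import Data.Bool as Bool
  open import Data.Bool.Properties
    using (xor-∧-commutativeRing; ∧-identityʳ; ∧-zeroʳ; ∧-distribˡ-xor; ∧-assoc; ∧-comm; ∧-idem;
           xor-same; xor-comm; xor-identityʳ; ¬-not)
  open import Data.Fin using (Fin; zero; suc; toℕ; punchIn; punchOut; _≟_)
  open import Data.Fin.Properties using (any?; punchInᵢ≢i; punchIn-punchOut; toℕ-injective)
  open import Data.Nat using (ℕ; zero; suc; _+_; _≤_; _<_; z≤n; s≤s; ⌈_/2⌉)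
  import Data.Nat as ℕ
  open import Data.Nat.Induction using (<-rec)
  open import Data.Nat.Properties using (+-comm; +-suc; m≤m+n; m≤n⇒m≤1+n; ⌊n/2⌋-mono; n≡⌊n+n/2⌋)
  open import Data.Product using (∃; _,_)
  open import Data.Sum using (_⊎_; inj₁; inj₂)
  open import Data.Vec.Functional using (insertAt; removeAt; tail)
  open import Data.Vec.Functional.Properties using (insertAt-lookup; insertAt-punchIn)
  open import Function using (_∘_)
  open import Relation.Nullary using (does; yes; no; contradiction)
  open import Relation.Binary.PropositionalEquality

  module 𝔽₂ = CommutativeRing xor-∧-commutativeRing
  module Σ₂ = SemiringSum 𝔽₂.semiring
  open CommutativeSemigroupProperties 𝔽₂.*-commutativeSemigroup using (x∙yz≈y∙xz)
  open CommutativeSemigroupProperties 𝔽₂.+-commutativeSemigroup using (interchange)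

  module _ {a ℓ} (M : Monoid a ℓ) where
    open Monoid M using (Carrier; _≈_; ε; ∙-congˡ; identityˡ; identityʳ) renaming (trans to ≈-trans)
    open MonoidSum M using (sum; sum-replicate-zero)

    sum-if-≟ : ∀ {n} (i : Fin n) (f : Fin n → Carrier) →
               sum (λ j → if does (i ≟ j) then f j else ε) ≈ f i
    sum-if-≟ {suc n} zero    f = ≈-trans (∙-congˡ (sum-replicate-zero n)) (identityʳ (f zero))
    sum-if-≟ {suc n} (suc i) f = ≈-trans (identityˡ _) (sum-if-≟ i (f ∘ suc))

  xor≡false⇒≡ : ∀ {x y} → x xor y ≡ false → x ≡ y
  xor≡false⇒≡ {false} {false} _ = refl
  xor≡false⇒≡ {true}  {true}  _ = refl

  Vec₂ : ℕ → Set
  Vec₂ n = Fin n → Bool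

  dot : ∀ {n} → Vec₂ n → Vec₂ n → Bool
  dot x y = Σ₂.sum (λ i → x i ∧ y i)

  combination : ∀ {m n} → (Fin m → Bool) → (Fin m → Vec₂ n) → Vec₂ n
  combination c v i = Σ₂.sum (λ j → c j ∧ v j i)

  Independent : ∀ {m n} → (Fin m → Vec₂ n) → Set
  Independent v = ∀ c → (∀ i → combination c v i ≡ false) → ∀ j → c j ≡ false

  xorSum≡sum : ∀ {m} (f : Fin m → Bool) → xorSum f ≡ Σ₂.sum f
  xorSum≡sum {zero}  f = refl
  xorSum≡sum {suc m} f = cong (f zero xor_) (xorSum≡sum (f ∘ suc))

  linIndepF2⇒independent : ∀ {m n} {v : Fin m → Vec₂ n} → LinIndepF2 v → Independent v
  linIndepF2⇒independent {v = v} ind c c·v≡0 =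
    ind c (λ i → trans (xorSum≡sum (λ j → c j ∧ v j i)) (c·v≡0 i))

  Orthogonal : ∀ {m r n} → (Fin m → Vec₂ n) → (Fin r → Vec₂ n) → Set
  Orthogonal u w = ∀ a b → dot (u a) (w b) ≡ false

  dot-comm : ∀ {n} (x y : Vec₂ n) → dot x y ≡ dot y x
  dot-comm x y = Σ₂.sum-cong-≗ (λ i → ∧-comm (x i) (y i))

  dot-cong : ∀ {n} {x x′ y y′ : Vec₂ n} → (∀ i → x i ≡ x′ i) → (∀ i → y i ≡ y′ i) → dot x y ≡ dot x′ y′
  dot-cong x≗x′ y≗y′ = Σ₂.sum-cong-≗ (λ i → cong₂ _∧_ (x≗x′ i) (y≗y′ i))

  dot-zeroʳ : ∀ {n} (x : Vec₂ n) {y : Vec₂ n} → (∀ i → y i ≡ false) → dot x y ≡ false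
  dot-zeroʳ {n} x y≗0 = trans (Σ₂.sum-cong-≗ (λ i → trans (cong (x i ∧_) (y≗0 i)) (∧-zeroʳ (x i))))
                          (Σ₂.sum-replicate-zero n)

  dot-combinationʳ : ∀ {m n} (x : Vec₂ n) (c : Fin m → Bool) (w : Fin m → Vec₂ n) →
                     dot x (combination c w) ≡ Σ₂.sum (λ b → c b ∧ dot x (w b))
  dot-combinationʳ x c w = begin
    Σ₂.sum (λ i → x i ∧ Σ₂.sum (λ b → c b ∧ w b i))
      ≡⟨ Σ₂.sum-cong-≗ (λ i → Σ₂.*-distribˡ-sum (x i) (λ b → c b ∧ w b i)) ⟩
    Σ₂.sum (λ i → Σ₂.sum (λ b → x i ∧ (c b ∧ w b i)))
      ≡⟨ Σ₂.∑-comm (λ i b → x i ∧ (c b ∧ w b i)) ⟩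
    Σ₂.sum (λ b → Σ₂.sum (λ i → x i ∧ (c b ∧ w b i)))
      ≡⟨ Σ₂.sum-cong-≗ (λ b → Σ₂.sum-cong-≗ (λ i → x∙yz≈y∙xz (x i) (c b) (w b i))) ⟩
    Σ₂.sum (λ b → Σ₂.sum (λ i → c b ∧ (x i ∧ w b i)))
      ≡⟨ Σ₂.sum-cong-≗ (λ b → sym (Σ₂.*-distribˡ-sum (c b) (λ i → x i ∧ w b i))) ⟩
    Σ₂.sum (λ b → c b ∧ dot x (w b)) ∎
    where open ≡-Reasoning

  combination-insertAt : ∀ {m n} (c : Fin m → Bool) (a : Fin (suc m)) (x : Bool)
                         (v : Fin (suc m) → Vec₂ n) i →
    combination (insertAt c a x) v i ≡ (x ∧ v a i) xor combination c (removeAt v a) i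
  combination-insertAt c a x v i = trans (Σ₂.sum-remove {i = a} (λ j → insertAt c a x j ∧ v j i))
    (cong₂ _xor_ (cong (_∧ v a i) (insertAt-lookup c a x))
                 (Σ₂.sum-cong-≗ (λ k → cong (_∧ v (punchIn a k) i) (insertAt-punchIn c a x k))))

  sum-∧-xor-∧ : ∀ {m} (c x y : Fin m → Bool) (s : Bool) →
    Σ₂.sum (λ k → c k ∧ (x k xor (s ∧ y k))) ≡
    Σ₂.sum (λ k → c k ∧ x k) xor (s ∧ Σ₂.sum (λ k → c k ∧ y k))
  sum-∧-xor-∧ c x y s = begin
    Σ₂.sum (λ k → c k ∧ (x k xor (s ∧ y k)))
      ≡⟨ Σ₂.sum-cong-≗ (λ k → ∧-distribˡ-xor (c k) (x k) (s ∧ y k)) ⟩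
    Σ₂.sum (λ k → (c k ∧ x k) xor (c k ∧ (s ∧ y k)))
      ≡⟨ Σ₂.∑-distrib-+ (λ k → c k ∧ x k) (λ k → c k ∧ (s ∧ y k)) ⟩
    Σ₂.sum (λ k → c k ∧ x k) xor Σ₂.sum (λ k → c k ∧ (s ∧ y k))
      ≡⟨ cong (Σ₂.sum (λ k → c k ∧ x k) xor_) (Σ₂.sum-cong-≗ (λ k → x∙yz≈y∙xz (c k) s (y k))) ⟩
    Σ₂.sum (λ k → c k ∧ x k) xor Σ₂.sum (λ k → s ∧ (c k ∧ y k))
      ≡⟨ cong (Σ₂.sum (λ k → c k ∧ x k) xor_) (Σ₂.*-distribˡ-sum s (λ k → c k ∧ y k)) ⟨
    Σ₂.sum (λ k → c k ∧ x k) xor (s ∧ Σ₂.sum (λ k → c k ∧ y k)) ∎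
    where open ≡-Reasoning

  independent-removeAt : ∀ {m n} {v : Fin (suc m) → Vec₂ n} (a : Fin (suc m)) →
                         Independent v → Independent (removeAt v a)
  independent-removeAt {v = v} a ind c c·v≡0 k = begin
    c k
      ≡⟨ insertAt-punchIn c a false k ⟨
    insertAt c a false (punchIn a k)
      ≡⟨ ind (insertAt c a false) lifted≡0 (punchIn a k) ⟩
    false ∎
    where
    open ≡-Reasoning
    lifted≡0 : ∀ i → combination (insertAt c a false) v i ≡ false
    lifted≡0 i = trans (combination-insertAt c a false v i) (c·v≡0 i)

  independent⇒injective : ∀ {m n} {v : Fin m → Vec₂ n} → Independent v →
                          ∀ {a b} → (∀ i → v a i ≡ v b i) → a ≡ b
  independent⇒injective {suc m} {v = v} ind {a} {b} va≗vb with a ≟ b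
  ... | yes a≡b = a≡b
  ... | no  a≢b =
    contradiction (trans (sym (insertAt-lookup δ a true)) (ind (insertAt δ a true) va+vb≡0 a)) λ ()
    where
    δ : Fin m → Bool
    δ k = does (punchOut a≢b ≟ k)
    va+vb≡0 : ∀ i → combination (insertAt δ a true) v i ≡ false
    va+vb≡0 i = begin
      combination (insertAt δ a true) v i
        ≡⟨ combination-insertAt δ a true v i ⟩
      v a i xor Σ₂.sum (λ k → δ k ∧ v (punchIn a k) i)
        ≡⟨ cong (v a i xor_) (Σ₂.sum-cong-≗ (λ k → ∧-as-if (δ k))) ⟩
      v a i xor Σ₂.sum (λ k → if δ k then v (punchIn a k) i else false)
        ≡⟨ cong (v a i xor_) (sum-if-≟ 𝔽₂.+-monoid (punchOut a≢b) (λ k → v (punchIn a k) i)) ⟩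
      v a i xor v (punchIn a (punchOut a≢b)) i
        ≡⟨ cong (λ j → v a i xor v j i) (punchIn-punchOut a≢b) ⟩
      v a i xor v b i
        ≡⟨ cong (v a i xor_) (sym (va≗vb i)) ⟩
      v a i xor v a i
        ≡⟨ xor-same (v a i) ⟩
      false ∎
      where
      open ≡-Reasoning
      ∧-as-if : ∀ d {y} → d ∧ y ≡ (if d then y else false)
      ∧-as-if false = refl
      ∧-as-if true  = refl

  independent-empty : ∀ {m} {v : Fin m → Vec₂ 0} → Independent v → m ≡ 0
  independent-empty {zero}  ind = refl
  independent-empty {suc m} ind with ind (λ _ → true) (λ ()) zero
  ... | ()

  independent-tail : ∀ {m n} {v : Fin m → Vec₂ (suc n)} → (∀ a → v a zero ≡ false) →
                     Independent v → Independent (tail ∘ v)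
  independent-tail {v = v} v₀≡0 ind c c·v′≡0 = ind c λ
    { zero    → dot-zeroʳ c v₀≡0
    ; (suc i) → c·v′≡0 i }

  orthogonal-tail : ∀ {m r n} {u : Fin m → Vec₂ (suc n)} {w : Fin r → Vec₂ (suc n)} →
                    (∀ a → u a zero ≡ false) → Orthogonal u w → Orthogonal (tail ∘ u) (tail ∘ w)
  orthogonal-tail {u = u} {w} u₀≡0 u⊥w a b =
    trans (cong (λ t → (t ∧ w b zero) xor dot (tail (u a)) (tail (w b))) (sym (u₀≡0 a))) (u⊥w a b)

  eliminate : ∀ {m n} → (Fin (suc m) → Vec₂ (suc n)) → Fin (suc m) → Fin m → Vec₂ n
  eliminate u a k i = u (punchIn a k) (suc i) xor (u (punchIn a k) zero ∧ u a (suc i))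

  independent-eliminate : ∀ {m n} {u : Fin (suc m) → Vec₂ (suc n)} {a} → u a zero ≡ true →
                          Independent u → Independent (eliminate u a)
  independent-eliminate {u = u} {a} ua₀≡1 ind c c·e≡0 k = begin
    c k                           ≡⟨ insertAt-punchIn c a X k ⟨
    insertAt c a X (punchIn a k)  ≡⟨ ind (insertAt c a X) lift≡0 (punchIn a k) ⟩
    false                         ∎
    where
    open ≡-Reasoning
    X = combination c (removeAt u a) zero
    lift≡0 : ∀ i → combination (insertAt c a X) u i ≡ false
    lift≡0 zero = begin
      combination (insertAt c a X) u zero  ≡⟨ combination-insertAt c a X u zero ⟩
      (X ∧ u a zero) xor X                 ≡⟨ cong (λ t → (X ∧ t) xor X) ua₀≡1 ⟩
      (X ∧ true) xor X                     ≡⟨ cong (_xor X) (∧-identityʳ X) ⟩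
      X xor X                              ≡⟨ xor-same X ⟩
      false                                ∎
    lift≡0 (suc i) = begin
      combination (insertAt c a X) u (suc i)
        ≡⟨ combination-insertAt c a X u (suc i) ⟩
      (X ∧ u a (suc i)) xor combination c (removeAt u a) (suc i)
        ≡⟨ xor-comm (X ∧ u a (suc i)) _ ⟩
      combination c (removeAt u a) (suc i) xor (X ∧ u a (suc i))
        ≡⟨ cong (combination c (removeAt u a) (suc i) xor_) (∧-comm X (u a (suc i))) ⟩
      combination c (removeAt u a) (suc i) xor (u a (suc i) ∧ X)
        ≡⟨ sum-∧-xor-∧ c (λ k → u (punchIn a k) (suc i)) (λ k → u (punchIn a k) zero) (u a (suc i)) ⟨
      Σ₂.sum (λ k → c k ∧ (u (punchIn a k) (suc i) xor (u a (suc i) ∧ u (punchIn a k) zero)))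
        ≡⟨ Σ₂.sum-cong-≗ (λ k → cong (λ t → c k ∧ (u (punchIn a k) (suc i) xor t))
                                     (∧-comm (u a (suc i)) (u (punchIn a k) zero))) ⟩
      combination c (eliminate u a) i
        ≡⟨ c·e≡0 i ⟩
      false ∎

  independent-tail-of-orthogonal : ∀ {r n} {x : Vec₂ (suc n)} {w : Fin r → Vec₂ (suc n)} →
    x zero ≡ true → (∀ b → dot x (w b) ≡ false) → Independent w → Independent (tail ∘ w)
  independent-tail-of-orthogonal {x = x} {w} x₀≡1 x⊥w ind c c·w′≡0 = ind c λ
    { zero    → head≡0
    ; (suc i) → c·w′≡0 i }
    where
    open ≡-Reasoning
    h = combination c w zero
    head≡0 : h ≡ false
    head≡0 = begin
      h
        ≡⟨ xor-identityʳ h ⟨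
      h xor false
        ≡⟨ cong (h xor_) (dot-zeroʳ (tail x) c·w′≡0) ⟨
      h xor dot (tail x) (tail (combination c w))
        ≡⟨ cong (λ t → (t ∧ h) xor dot (tail x) (tail (combination c w))) x₀≡1 ⟨
      dot x (combination c w)
        ≡⟨ dot-combinationʳ x c w ⟩
      Σ₂.sum (λ b → c b ∧ dot x (w b))
        ≡⟨ dot-zeroʳ c x⊥w ⟩
      false ∎

  orthogonal-eliminate : ∀ {m r n} {u : Fin (suc m) → Vec₂ (suc n)} {w : Fin r → Vec₂ (suc n)} {a} →
    u a zero ≡ true → Orthogonal u w → Orthogonal (eliminate u a) (tail ∘ w)
  orthogonal-eliminate {u = u} {w} {a} ua₀≡1 u⊥w k b = begin
    dot (eliminate u a k) (tail (w b))
      ≡⟨ dot-comm (eliminate u a k) (tail (w b)) ⟩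
    dot (tail (w b)) (eliminate u a k)
      ≡⟨ sum-∧-xor-∧ (tail (w b)) (tail (u (punchIn a k))) (tail (u a)) t ⟩
    dot (tail (w b)) (tail (u (punchIn a k))) xor (t ∧ dot (tail (w b)) (tail (u a)))
      ≡⟨ cong₂ (λ p q → p xor (t ∧ q)) tail-dot₁ tail-dot₂ ⟩
    (t ∧ w b zero) xor (t ∧ w b zero)
      ≡⟨ xor-same (t ∧ w b zero) ⟩
    false ∎
    where
    open ≡-Reasoning
    t = u (punchIn a k) zero
    tail-dot₁ : dot (tail (w b)) (tail (u (punchIn a k))) ≡ t ∧ w b zero
    tail-dot₁ = trans (dot-comm (tail (w b)) _) (sym (xor≡false⇒≡ (u⊥w (punchIn a k) b)))
    tail-dot₂ : dot (tail (w b)) (tail (u a)) ≡ w b zero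
    tail-dot₂ = trans (dot-comm (tail (w b)) (tail (u a))) (sym (xor≡false⇒≡ ua·wb≡0))
      where
      ua·wb≡0 : (true ∧ w b zero) xor dot (tail (u a)) (tail (w b)) ≡ false
      ua·wb≡0 = subst (λ s → (s ∧ w b zero) xor dot (tail (u a)) (tail (w b)) ≡ false) ua₀≡1 (u⊥w a b)

  orthogonal-sym : ∀ {m r n} {u : Fin m → Vec₂ n} {w : Fin r → Vec₂ n} → Orthogonal u w → Orthogonal w u
  orthogonal-sym {u = u} {w} u⊥w b a = trans (dot-comm (w b) (u a)) (u⊥w a b)

  -- Gaussian elimination on the first coordinate, with the pivot taken from u or from w.
  independent-orthogonal-≤ : ∀ {n m r} {u : Fin m → Vec₂ n} {w : Fin r → Vec₂ n} →
    Independent u → Independent w → Orthogonal u w → m + r ≤ n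

  pivot-≤ : ∀ {n m r} {u : Fin m → Vec₂ (suc n)} {w : Fin r → Vec₂ (suc n)} {a : Fin m} →
    u a zero ≡ true → Independent u → Independent w → Orthogonal u w → m + r ≤ suc n
  pivot-≤ {m = suc m} {u = u} {w} {a} ua₀≡1 iu iw u⊥w = s≤s (independent-orthogonal-≤
    (independent-eliminate {u = u} ua₀≡1 iu)
    (independent-tail-of-orthogonal {x = u a} {w} ua₀≡1 (u⊥w a) iw)
    (orthogonal-eliminate {u = u} {w} ua₀≡1 u⊥w))

  independent-orthogonal-≤ {zero} iu iw _ rewrite independent-empty iu | independent-empty iw = z≤n
  independent-orthogonal-≤ {suc n} {m} {r} {u} {w} iu iw u⊥w
    with any? (λ a → u a zero Bool.≟ true) | any? (λ b → w b zero Bool.≟ true)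
  ... | yes (_ , ua₀≡1) | _ = pivot-≤ ua₀≡1 iu iw u⊥w
  ... | no _ | yes (_ , wb₀≡1) =
    subst (_≤ suc n) (+-comm r m) (pivot-≤ wb₀≡1 iw iu (orthogonal-sym {u = u} {w} u⊥w))
  ... | no ¬pivotᵤ | no ¬pivotʷ =
    m≤n⇒m≤1+n (independent-orthogonal-≤ (independent-tail {v = u} u₀≡0 iu)
                                         (independent-tail {v = w} w₀≡0 iw)
                                         (orthogonal-tail {u = u} {w} u₀≡0 u⊥w))
    where
    u₀≡0 : ∀ a → u a zero ≡ false
    u₀≡0 a = ¬-not (¬pivotᵤ ∘ (a ,_))
    w₀≡0 : ∀ b → w b zero ≡ false
    w₀≡0 b = ¬-not (¬pivotʷ ∘ (b ,_))

  Mat₂ : ℕ → Set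
  Mat₂ n = Fin n → Fin n → Bool

  infixr 7 _·₂_
  _·₂_ : ∀ {n} → Mat₂ n → Vec₂ n → Vec₂ n
  (B ·₂ x) i = dot (B i) x

  IsSymmetric : ∀ {n} → Mat₂ n → Set
  IsSymmetric B = ∀ i j → B i j ≡ B j i

  𝟙₂ : ∀ {n} → Vec₂ n
  𝟙₂ _ = true

  dot-self : ∀ {n} (x : Vec₂ n) → dot x x ≡ dot 𝟙₂ x
  dot-self x = Σ₂.sum-cong-≗ (λ i → ∧-idem (x i))

  dot-scaleˡ : ∀ {n} (s : Bool) (x y : Vec₂ n) → dot (λ i → s ∧ x i) y ≡ s ∧ dot x y
  dot-scaleˡ s x y =
    trans (Σ₂.sum-cong-≗ (λ i → ∧-assoc s (x i) (y i))) (sym (Σ₂.*-distribˡ-sum s (λ i → x i ∧ y i)))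

  ·₂-selfAdjoint : ∀ {n} {B : Mat₂ n} → IsSymmetric B → ∀ x y → dot (B ·₂ x) y ≡ dot x (B ·₂ y)
  ·₂-selfAdjoint {B = B} B-sym x y = begin
    dot (B ·₂ x) y
      ≡⟨ dot-comm (B ·₂ x) y ⟩
    dot y (B ·₂ x)
      ≡⟨ dot-cong (λ _ → refl) (λ i → Σ₂.sum-cong-≗ (λ j → trans (cong (_∧ x j) (B-sym i j))
                                                                  (∧-comm (B j i) (x j)))) ⟩
    dot y (combination x B)
      ≡⟨ dot-combinationʳ y x B ⟩
    Σ₂.sum (λ j → x j ∧ dot y (B j))
      ≡⟨ Σ₂.sum-cong-≗ (λ j → cong (x j ∧_) (dot-comm y (B j))) ⟩
    dot x (B ·₂ y) ∎
    where open ≡-Reasoning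

  -- Over 𝔽₂ the off-diagonal terms of x·Bx cancel in pairs, and x i ∧ x i = x i.
  dot-·₂-self : ∀ {n} {B : Mat₂ n} → IsSymmetric B → ∀ x → dot x (B ·₂ x) ≡ dot (λ i → B i i) x
  dot-·₂-self {zero}  B-sym x = refl
  dot-·₂-self {suc n} {B} B-sym x = begin
    dot x (B ·₂ x)
      ≡⟨⟩
    (x₀ ∧ ((B zero zero ∧ x₀) xor dot r x′)) xor dot x′ (tail (B ·₂ x))
      ≡⟨ cong₂ (λ p q → (x₀ ∧ ((B zero zero ∧ x₀) xor p)) xor q) (dot-comm r x′) tail-part ⟩
    (x₀ ∧ ((B zero zero ∧ x₀) xor R)) xor (Q′ xor (x₀ ∧ R))
      ≡⟨ collect x₀ (B zero zero) ⟩
    (B zero zero ∧ x₀) xor Q′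
      ≡⟨ cong ((B zero zero ∧ x₀) xor_) (dot-·₂-self (λ i j → B-sym (suc i) (suc j)) x′) ⟩
    dot (λ i → B i i) x ∎
    where
    open ≡-Reasoning
    x₀ = x zero
    x′ = tail x
    r = tail (B zero)
    B′ : Mat₂ n
    B′ i j = B (suc i) (suc j)
    R = dot x′ r
    Q′ = dot x′ (B′ ·₂ x′)
    tail-row : ∀ i → (B ·₂ x) (suc i) ≡ (B′ ·₂ x′) i xor (x₀ ∧ r i)
    tail-row i = trans (xor-comm (B (suc i) zero ∧ x₀) ((B′ ·₂ x′) i))
      (cong ((B′ ·₂ x′) i xor_) (trans (cong (_∧ x₀) (B-sym (suc i) zero)) (∧-comm (r i) x₀)))
    tail-part : dot x′ (tail (B ·₂ x)) ≡ Q′ xor (x₀ ∧ R)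
    tail-part = trans (Σ₂.sum-cong-≗ (λ i → cong (x′ i ∧_) (tail-row i)))
                      (sum-∧-xor-∧ x′ (B′ ·₂ x′) r x₀)
    collect : ∀ a b → (a ∧ ((b ∧ a) xor R)) xor (Q′ xor (a ∧ R)) ≡ (b ∧ a) xor Q′
    collect false b = trans (xor-identityʳ Q′) (cong (_xor Q′) (sym (∧-zeroʳ b)))
    collect true  b = begin
      ((b ∧ true) xor R) xor (Q′ xor R)  ≡⟨ interchange (b ∧ true) R Q′ R ⟩
      ((b ∧ true) xor Q′) xor (R xor R)  ≡⟨ cong (((b ∧ true) xor Q′) xor_) (xor-same R) ⟩
      ((b ∧ true) xor Q′) xor false      ≡⟨ xor-identityʳ _ ⟩
      (b ∧ true) xor Q′                  ∎

  krylov : ∀ {n} → Mat₂ n → Vec₂ n → ℕ → Vec₂ n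
  krylov B x zero    = x
  krylov B x (suc k) = B ·₂ krylov B x k

  dot-krylov : ∀ {n} {B : Mat₂ n} → IsSymmetric B → ∀ a b x y →
               dot (krylov B x a) (krylov B y b) ≡ dot x (krylov B y (a + b))
  dot-krylov B-sym zero    b x y = refl
  dot-krylov {B = B} B-sym (suc a) b x y = begin
    dot (B ·₂ krylov B x a) (krylov B y b)   ≡⟨ ·₂-selfAdjoint B-sym (krylov B x a) (krylov B y b) ⟩
    dot (krylov B x a) (krylov B y (suc b))  ≡⟨ dot-krylov B-sym a (suc b) x y ⟩
    dot x (krylov B y (a + suc b))           ≡⟨ cong (dot x ∘ krylov B y) (+-suc a b) ⟩
    dot x (krylov B y (suc a + b))           ∎
    where open ≡-Reasoning

  even-or-odd : ∀ k → ∃ λ t → k ≡ t + t ⊎ k ≡ suc (t + t)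
  even-or-odd zero = zero , inj₁ refl
  even-or-odd (suc k) with even-or-odd k
  ... | t , inj₁ k≡2t  = t , inj₂ (cong suc k≡2t)
  ... | t , inj₂ k≡2t+1 = suc t , inj₁ (trans (cong suc k≡2t+1) (cong suc (sym (+-suc t t))))

  module KrylovIsotropy {n} {T : Mat₂ n} {d : Vec₂ n} {γ p : Bool} (T-sym : IsSymmetric T)
    (T·𝟙≡γd : ∀ i → (T ·₂ 𝟙₂) i ≡ γ ∧ d i) (diagT≡pd : ∀ i → T i i ≡ p ∧ d i)
    (𝟙·d≡0 : dot 𝟙₂ d ≡ false) where

    private
      open ≡-Reasoning

      dot-𝟙-krylov-suc : ∀ k → dot 𝟙₂ (krylov T d (suc k)) ≡ γ ∧ dot d (krylov T d k)
      dot-𝟙-krylov-suc k = begin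
        dot 𝟙₂ (T ·₂ krylov T d k)          ≡⟨ ·₂-selfAdjoint T-sym 𝟙₂ (krylov T d k) ⟨
        dot (T ·₂ 𝟙₂) (krylov T d k)        ≡⟨ dot-cong T·𝟙≡γd (λ _ → refl) ⟩
        dot (λ i → γ ∧ d i) (krylov T d k)  ≡⟨ dot-scaleˡ γ d (krylov T d k) ⟩
        γ ∧ dot d (krylov T d k)            ∎

      dot-d-krylov-even : ∀ t → dot d (krylov T d (t + t)) ≡ dot 𝟙₂ (krylov T d t)
      dot-d-krylov-even t = trans (sym (dot-krylov T-sym t t d d)) (dot-self (krylov T d t))

      dot-d-krylov-odd : ∀ t → dot d (krylov T d (suc (t + t))) ≡ p ∧ dot d (krylov T d t)
      dot-d-krylov-odd t = begin
        dot d (krylov T d (suc (t + t)))        ≡⟨ cong (dot d ∘ krylov T d) (+-suc t t) ⟨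
        dot d (krylov T d (t + suc t))          ≡⟨ dot-krylov T-sym t (suc t) d d ⟨
        dot (krylov T d t) (T ·₂ krylov T d t)  ≡⟨ dot-·₂-self T-sym (krylov T d t) ⟩
        dot (λ i → T i i) (krylov T d t)        ≡⟨ dot-cong diagT≡pd (λ _ → refl) ⟩
        dot (λ i → p ∧ d i) (krylov T d t)      ≡⟨ dot-scaleˡ p d (krylov T d t) ⟩
        p ∧ dot d (krylov T d t)                ∎

    dot-d-krylov≡0 : ∀ k → dot d (krylov T d k) ≡ false
    dot-d-krylov≡0 = <-rec _ step
      where
      step : ∀ k → (∀ {j} → j < k → dot d (krylov T d j) ≡ false) → dot d (krylov T d k) ≡ false
      step k rec with even-or-odd k
      ... | zero  , inj₁ refl = trans (dot-d-krylov-even zero) 𝟙·d≡0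
      ... | suc t , inj₁ refl = begin
        dot d (krylov T d (suc t + suc t))  ≡⟨ dot-d-krylov-even (suc t) ⟩
        dot 𝟙₂ (krylov T d (suc t))         ≡⟨ dot-𝟙-krylov-suc t ⟩
        γ ∧ dot d (krylov T d t)            ≡⟨ cong (γ ∧_) (rec (s≤s (m≤m+n t (suc t)))) ⟩
        γ ∧ false                           ≡⟨ ∧-zeroʳ γ ⟩
        false                               ∎
      ... | t , inj₂ refl = begin
        dot d (krylov T d (suc (t + t)))  ≡⟨ dot-d-krylov-odd t ⟩
        p ∧ dot d (krylov T d t)          ≡⟨ cong (p ∧_) (rec (s≤s (m≤m+n t t))) ⟩
        p ∧ false                         ≡⟨ ∧-zeroʳ p ⟩
        false                             ∎

    dot-𝟙-krylov≡0 : ∀ k → dot 𝟙₂ (krylov T d k) ≡ false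
    dot-𝟙-krylov≡0 zero    = 𝟙·d≡0
    dot-𝟙-krylov≡0 (suc k) =
      trans (dot-𝟙-krylov-suc k) (trans (cong (γ ∧_) (dot-d-krylov≡0 k)) (∧-zeroʳ γ))

    dot-krylov≡0 : ∀ a b → dot (krylov T d a) (krylov T d b) ≡ false
    dot-krylov≡0 a b = trans (dot-krylov T-sym a b d d) (dot-d-krylov≡0 (a + b))

  independent-orthogonal-but-one-≤ : ∀ {m n} {v : Fin m → Vec₂ n} (j : Fin m) → Independent v →
    (∀ a b → b ≢ j → dot (v a) (v b) ≡ false) → m + m ≤ suc n
  independent-orthogonal-but-one-≤ {suc m} {n} {v} j ind v⊥v =
    subst (_≤ suc n) (cong suc (sym (+-suc m m)))
      (s≤s (independent-orthogonal-≤ ind (independent-removeAt {v = v} j ind)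
                                         (λ a b → v⊥v a (punchIn j b) (punchInᵢ≢i j b))))

  m+m≤1+n⇒m≤⌈n/2⌉ : ∀ {m n} → m + m ≤ suc n → m ≤ ⌈ n /2⌉
  m+m≤1+n⇒m≤⌈n/2⌉ {m} m+m≤1+n = subst (_≤ _) (sym (n≡⌊n+n/2⌋ m)) (⌊n/2⌋-mono m+m≤1+n)

  independent-selection-≤ : ∀ {n k m} (C : Fin k → Vec₂ n) →
    (∀ c c′ → toℕ c ≢ 0 → dot (C c) (C c′) ≡ false) →
    (s : Fin m → Fin k) → Independent (C ∘ s) → m ≤ ⌈ n /2⌉
  independent-selection-≤ C C⊥C s ind with any? (λ j → toℕ (s j) ℕ.≟ 0)
  ... | no ¬first =
    m+m≤1+n⇒m≤⌈n/2⌉ (m≤n⇒m≤1+n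
      (independent-orthogonal-≤ ind ind (λ a b → C⊥C (s a) (s b) (¬first ∘ (a ,_)))))
  ... | yes (j , sj≡0) = m+m≤1+n⇒m≤⌈n/2⌉ (independent-orthogonal-but-one-≤ j ind λ a b b≢j →
    trans (dot-comm (C (s a)) (C (s b))) (C⊥C (s b) (s a) (b≢j ∘ same-column-as-j b)))
    where
    same-column-as-j : ∀ b → toℕ (s b) ≡ 0 → b ≡ j
    same-column-as-j b sb≡0 =
      independent⇒injective ind (λ i → cong (λ c → C c i) (toℕ-injective (trans sb≡0 (sym sj≡0))))

module ReductionMod2 where

  open LinearAlgebraOver𝔽₂
  import Algebra.Properties.CommutativeSemigroup as CommutativeSemigroupProperties
  import Algebra.Properties.Semiring.Sum as SemiringSum
  open import Data.Bool using (Bool; true; false; if_then_else_; _xor_; _∧_)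
  open import Data.Fin using (Fin; zero; suc; _≟_)
  open import Data.Integer as ℤ using (ℤ; +_; -[1+_]; ∣_∣; _⊖_)
  open import Data.Integer.DivMod using () renaming (_/_ to _divℤ_)
  import Data.Integer.Properties as ℤₚ
  open import Data.Nat as ℕ using (zero; suc; parity)
  open import Data.Nat.DivMod using (m*n/n≡m; m*n%n≡0)
  open import Data.Nat.Properties using (+-suc; *-comm)
  open import Data.Parity.Base as ℙ using (Parity; 0ℙ; 1ℙ)
  open import Data.Parity.Properties
    using (+-homo-+; *-homo-*) renaming (+-identityʳ to ℙ+-identityʳ; +-comm to ℙ+-comm)
  open import Function using (_∘_)
  open import Relation.Nullary using (does)
  open import Relation.Binary.PropositionalEquality

  module Σℤ = SemiringSum ℤₚ.+-*-semiring
  open CommutativeSemigroupProperties ℤₚ.*-commutativeSemigroup using (x∙yz≈y∙xz)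

  parityBit : Parity → Bool
  parityBit 0ℙ = false
  parityBit 1ℙ = true

  parityBit-+ : ∀ p q → parityBit (p ℙ.+ q) ≡ parityBit p xor parityBit q
  parityBit-+ 0ℙ q  = refl
  parityBit-+ 1ℙ 0ℙ = refl
  parityBit-+ 1ℙ 1ℙ = refl

  parityBit-* : ∀ p q → parityBit (p ℙ.* q) ≡ parityBit p ∧ parityBit q
  parityBit-* 0ℙ q = refl
  parityBit-* 1ℙ q = refl

  mod2≡parityBit : ∀ x → mod2 x ≡ parityBit (parity ∣ x ∣)
  mod2≡parityBit x = %2≟1≡parityBit ∣ x ∣
    where
    %2≟1≡parityBit : ∀ n → does (n ℕ.% 2 ℕ.≟ 1) ≡ parityBit (parity n)
    %2≟1≡parityBit zero          = refl
    %2≟1≡parityBit (suc zero)    = refl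
    %2≟1≡parityBit (suc (suc n)) = %2≟1≡parityBit n

  parity-suc-+-suc : ∀ m n → parity (suc m) ℙ.+ parity (suc n) ≡ parity m ℙ.+ parity n
  parity-suc-+-suc m n = begin
    parity (suc m) ℙ.+ parity (suc n)  ≡⟨ +-homo-+ (suc m) (suc n) ⟨
    parity (suc m ℕ.+ suc n)           ≡⟨ cong (parity ∘ suc) (+-suc m n) ⟩
    parity (m ℕ.+ n)                   ≡⟨ +-homo-+ m n ⟩
    parity m ℙ.+ parity n              ∎
    where open ≡-Reasoning

  parity-∣⊖∣ : ∀ m n → parity ∣ m ⊖ n ∣ ≡ parity m ℙ.+ parity n
  parity-∣⊖∣ zero    zero    = refl
  parity-∣⊖∣ zero    (suc n) = refl
  parity-∣⊖∣ (suc m) zero    = sym (ℙ+-identityʳ (parity (suc m)))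
  parity-∣⊖∣ (suc m) (suc n) = trans (cong (parity ∘ ∣_∣) (ℤₚ.[1+m]⊖[1+n]≡m⊖n m n))
                                 (trans (parity-∣⊖∣ m n) (sym (parity-suc-+-suc m n)))

  parity-∣+∣ : ∀ x y → parity ∣ x ℤ.+ y ∣ ≡ parity ∣ x ∣ ℙ.+ parity ∣ y ∣
  parity-∣+∣ (+ m)    (+ n)    = +-homo-+ m n
  parity-∣+∣ (+ m)    -[1+ n ] = parity-∣⊖∣ m (suc n)
  parity-∣+∣ -[1+ m ] (+ n)    = trans (parity-∣⊖∣ n (suc m)) (ℙ+-comm (parity n) (parity (suc m)))
  parity-∣+∣ -[1+ m ] -[1+ n ] = trans (+-homo-+ m n) (sym (parity-suc-+-suc m n))

  mod2-+ : ∀ x y → mod2 (x ℤ.+ y) ≡ mod2 x xor mod2 y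
  mod2-+ x y = begin
    mod2 (x ℤ.+ y)
      ≡⟨ mod2≡parityBit (x ℤ.+ y) ⟩
    parityBit (parity ∣ x ℤ.+ y ∣)
      ≡⟨ cong parityBit (parity-∣+∣ x y) ⟩
    parityBit (parity ∣ x ∣ ℙ.+ parity ∣ y ∣)
      ≡⟨ parityBit-+ (parity ∣ x ∣) (parity ∣ y ∣) ⟩
    parityBit (parity ∣ x ∣) xor parityBit (parity ∣ y ∣)
      ≡⟨ cong₂ _xor_ (mod2≡parityBit x) (mod2≡parityBit y) ⟨
    mod2 x xor mod2 y ∎
    where open ≡-Reasoning

  mod2-* : ∀ x y → mod2 (x ℤ.* y) ≡ mod2 x ∧ mod2 y
  mod2-* x y = begin
    mod2 (x ℤ.* y)                                       ≡⟨ mod2≡parityBit (x ℤ.* y) ⟩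
    parityBit (parity ∣ x ℤ.* y ∣)                       ≡⟨ cong (parityBit ∘ parity) (ℤₚ.abs-* x y) ⟩
    parityBit (parity (∣ x ∣ ℕ.* ∣ y ∣))                 ≡⟨ cong parityBit (*-homo-* ∣ x ∣ ∣ y ∣) ⟩
    parityBit (parity ∣ x ∣ ℙ.* parity ∣ y ∣)            ≡⟨ parityBit-* (parity ∣ x ∣) (parity ∣ y ∣) ⟩
    parityBit (parity ∣ x ∣) ∧ parityBit (parity ∣ y ∣)  ≡⟨ cong₂ _∧_ (mod2≡parityBit x) (mod2≡parityBit y) ⟨
    mod2 x ∧ mod2 y                                      ∎
    where open ≡-Reasoning

  mod2-boolℤ : ∀ b → mod2 (boolℤ b) ≡ b
  mod2-boolℤ true  = refl
  mod2-boolℤ false = refl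

  mod2-sumℤ : ∀ {m} (f : Fin m → ℤ) → mod2 (sumℤ f) ≡ Σ₂.sum (mod2 ∘ f)
  mod2-sumℤ {zero}  f = refl
  mod2-sumℤ {suc m} f =
    trans (mod2-+ (f zero) (sumℤ (f ∘ suc))) (cong (mod2 (f zero) xor_) (mod2-sumℤ (f ∘ suc)))

  sumℤ≡sum : ∀ {m} (f : Fin m → ℤ) → sumℤ f ≡ Σℤ.sum f
  sumℤ≡sum {zero}  f = refl
  sumℤ≡sum {suc m} f = cong (λ s → f zero ℤ.+ s) (sumℤ≡sum (f ∘ suc))

  ·ᵥ≡sum : ∀ {n} (M : Matℤ n n) (v : Vecℤ n) i → (M ·ᵥ v) i ≡ Σℤ.sum (λ j → M i j ℤ.* v j)
  ·ᵥ≡sum M v i = sumℤ≡sum (λ j → M i j ℤ.* v j)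

  ·ᵥ-cong : ∀ {n} (M : Matℤ n n) {v w : Vecℤ n} → (∀ j → v j ≡ w j) → ∀ i → (M ·ᵥ v) i ≡ (M ·ᵥ w) i
  ·ᵥ-cong M {v} {w} v≗w i = begin
    (M ·ᵥ v) i                    ≡⟨ ·ᵥ≡sum M v i ⟩
    Σℤ.sum (λ j → M i j ℤ.* v j)  ≡⟨ Σℤ.sum-cong-≗ (λ j → cong (M i j ℤ.*_) (v≗w j)) ⟩
    Σℤ.sum (λ j → M i j ℤ.* w j)  ≡⟨ ·ᵥ≡sum M w i ⟨
    (M ·ᵥ w) i                    ∎
    where open ≡-Reasoning

  ·ᵥ-scale : ∀ {n} (M : Matℤ n n) c (v : Vecℤ n) i → (M ·ᵥ (λ j → c ℤ.* v j)) i ≡ c ℤ.* (M ·ᵥ v) i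
  ·ᵥ-scale M c v i = begin
    (M ·ᵥ (λ j → c ℤ.* v j)) i            ≡⟨ ·ᵥ≡sum M (λ j → c ℤ.* v j) i ⟩
    Σℤ.sum (λ j → M i j ℤ.* (c ℤ.* v j))  ≡⟨ Σℤ.sum-cong-≗ (λ j → x∙yz≈y∙xz (M i j) c (v j)) ⟩
    Σℤ.sum (λ j → c ℤ.* (M i j ℤ.* v j))  ≡⟨ Σℤ.*-distribˡ-sum c (λ j → M i j ℤ.* v j) ⟨
    c ℤ.* Σℤ.sum (λ j → M i j ℤ.* v j)    ≡⟨ cong (c ℤ.*_) (·ᵥ≡sum M v i) ⟨
    c ℤ.* (M ·ᵥ v) i                      ∎
    where open ≡-Reasoning

  idMat-·ᵥ : ∀ {n} (v : Vecℤ n) i → (idMat ·ᵥ v) i ≡ v i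
  idMat-·ᵥ v i = begin
    (idMat ·ᵥ v) i                                    ≡⟨ ·ᵥ≡sum idMat v i ⟩
    Σℤ.sum (λ j → idMat i j ℤ.* v j)                  ≡⟨ Σℤ.sum-cong-≗ (λ j → δ-* (does (i ≟ j)) (v j)) ⟩
    Σℤ.sum (λ j → if does (i ≟ j) then v j else + 0)  ≡⟨ sum-if-≟ ℤₚ.+-0-monoid i v ⟩
    v i                                               ∎
    where
    open ≡-Reasoning
    δ-* : ∀ b y → (if b then + 1 else + 0) ℤ.* y ≡ (if b then y else + 0)
    δ-* true  y = ℤₚ.*-identityˡ y
    δ-* false y = refl

  ·ₘ-·ᵥ : ∀ {n} (M N : Matℤ n n) (v : Vecℤ n) i → ((M ·ₘ N) ·ᵥ v) i ≡ (M ·ᵥ (N ·ᵥ v)) i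
  ·ₘ-·ᵥ M N v i = begin
    ((M ·ₘ N) ·ᵥ v) i
      ≡⟨ ·ᵥ≡sum (M ·ₘ N) v i ⟩
    Σℤ.sum (λ j → (M ·ₘ N) i j ℤ.* v j)
      ≡⟨ Σℤ.sum-cong-≗ (λ j → cong (ℤ._* v j) (sumℤ≡sum (λ k → M i k ℤ.* N k j))) ⟩
    Σℤ.sum (λ j → Σℤ.sum (λ k → M i k ℤ.* N k j) ℤ.* v j)
      ≡⟨ Σℤ.sum-cong-≗ (λ j → Σℤ.*-distribʳ-sum (v j) (λ k → M i k ℤ.* N k j)) ⟩
    Σℤ.sum (λ j → Σℤ.sum (λ k → M i k ℤ.* N k j ℤ.* v j))
      ≡⟨ Σℤ.∑-comm (λ j k → M i k ℤ.* N k j ℤ.* v j) ⟩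
    Σℤ.sum (λ k → Σℤ.sum (λ j → M i k ℤ.* N k j ℤ.* v j))
      ≡⟨ Σℤ.sum-cong-≗ (λ k → Σℤ.sum-cong-≗ (λ j → ℤₚ.*-assoc (M i k) (N k j) (v j))) ⟩
    Σℤ.sum (λ k → Σℤ.sum (λ j → M i k ℤ.* (N k j ℤ.* v j)))
      ≡⟨ Σℤ.sum-cong-≗ (λ k → Σℤ.*-distribˡ-sum (M i k) (λ j → N k j ℤ.* v j)) ⟨
    Σℤ.sum (λ k → M i k ℤ.* Σℤ.sum (λ j → N k j ℤ.* v j))
      ≡⟨ Σℤ.sum-cong-≗ (λ k → cong (M i k ℤ.*_) (·ᵥ≡sum N v k)) ⟨
    Σℤ.sum (λ k → M i k ℤ.* (N ·ᵥ v) k)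
      ≡⟨ ·ᵥ≡sum M (N ·ᵥ v) i ⟨
    (M ·ᵥ (N ·ᵥ v)) i ∎
    where open ≡-Reasoning

  ^ₘ-suc-·ᵥ : ∀ {n} (M : Matℤ n n) k (v : Vecℤ n) i → ((M ^ₘ suc k) ·ᵥ v) i ≡ ((M ^ₘ k) ·ᵥ (M ·ᵥ v)) i
  ^ₘ-suc-·ᵥ M zero v i = begin
    ((M ·ₘ idMat) ·ᵥ v) i  ≡⟨ ·ₘ-·ᵥ M idMat v i ⟩
    (M ·ᵥ (idMat ·ᵥ v)) i  ≡⟨ ·ᵥ-cong M (idMat-·ᵥ v) i ⟩
    (M ·ᵥ v) i             ≡⟨ idMat-·ᵥ (M ·ᵥ v) i ⟨
    (idMat ·ᵥ (M ·ᵥ v)) i  ∎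
    where open ≡-Reasoning
  ^ₘ-suc-·ᵥ M (suc k) v i = begin
    ((M ·ₘ (M ^ₘ suc k)) ·ᵥ v) i     ≡⟨ ·ₘ-·ᵥ M (M ^ₘ suc k) v i ⟩
    (M ·ᵥ ((M ^ₘ suc k) ·ᵥ v)) i     ≡⟨ ·ᵥ-cong M (^ₘ-suc-·ᵥ M k v) i ⟩
    (M ·ᵥ ((M ^ₘ k) ·ᵥ (M ·ᵥ v))) i  ≡⟨ ·ₘ-·ᵥ M (M ^ₘ k) (M ·ᵥ v) i ⟨
    ((M ·ₘ (M ^ₘ k)) ·ᵥ (M ·ᵥ v)) i  ∎
    where open ≡-Reasoning

  reduce₂ : ∀ {n} → Matℤ n n → Mat₂ n
  reduce₂ M i j = mod2 (M i j)

  mod2-·ᵥ : ∀ {n} (M : Matℤ n n) (v : Vecℤ n) i → mod2 ((M ·ᵥ v) i) ≡ (reduce₂ M ·₂ (mod2 ∘ v)) i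
  mod2-·ᵥ M v i = trans (mod2-sumℤ (λ j → M i j ℤ.* v j)) (Σ₂.sum-cong-≗ (λ j → mod2-* (M i j) (v j)))

  mod2-^ₘ-·ᵥ : ∀ {n} (M : Matℤ n n) (v : Vecℤ n) k i →
               mod2 (((M ^ₘ k) ·ᵥ v) i) ≡ krylov (reduce₂ M) (mod2 ∘ v) k i
  mod2-^ₘ-·ᵥ M v zero    i = cong mod2 (idMat-·ᵥ v i)
  mod2-^ₘ-·ᵥ M v (suc k) i = begin
    mod2 (((M ·ₘ (M ^ₘ k)) ·ᵥ v) i)                   ≡⟨ cong mod2 (·ₘ-·ᵥ M (M ^ₘ k) v i) ⟩
    mod2 ((M ·ᵥ ((M ^ₘ k) ·ᵥ v)) i)                   ≡⟨ mod2-·ᵥ M ((M ^ₘ k) ·ᵥ v) i ⟩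
    (reduce₂ M ·₂ (mod2 ∘ ((M ^ₘ k) ·ᵥ v))) i         ≡⟨ dot-cong (λ _ → refl) (mod2-^ₘ-·ᵥ M v k) ⟩
    (reduce₂ M ·₂ krylov (reduce₂ M) (mod2 ∘ v) k) i  ∎
    where open ≡-Reasoning

  *-divℤ-cancelˡ : ∀ d x → (+ suc d ℤ.* x) divℤ + suc d ≡ x
  *-divℤ-cancelˡ d x = trans (ℤₚ.*-identityˡ _) (exact x)
    where
    quotient : ∀ n → suc d ℕ.* n ℕ./ suc d ≡ n
    quotient n = trans (cong (ℕ._/ suc d) (*-comm (suc d) n)) (m*n/n≡m n (suc d))
    exact : ∀ x → (+ suc d ℤ.* x) ℤ./ℕ suc d ≡ x
    exact (+ n) = trans (cong (ℤ._/ℕ suc d) (sym (ℤₚ.pos-* (suc d) n))) (cong +_ (quotient n))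
    exact -[1+ n ] with suc d ℕ.* suc n ℕ.% suc d in remainder
    ... | zero  = cong (ℤ.-_ ∘ +_) (quotient (suc n))
    ... | suc _ with () ← trans (sym remainder) (trans (cong (ℕ._% suc d) (*-comm (suc d) (suc n)))
                                                       (m*n%n≡0 (suc n) (suc d)))

module WalkMatrix where

  open LinearAlgebraOver𝔽₂
  open ReductionMod2
  open import Data.Bool using (false; _xor_; _∧_)
  open import Data.Bool.Properties using (∧-identityʳ; ∧-zeroʳ; xor-identityʳ)
  open import Data.Fin using (Fin; zero; suc; toℕ; _≟_)
  open import Data.Integer as ℤ using (+_)
  import Data.Integer.Properties as ℤₚ
  open import Data.Integer.DivMod using () renaming (_/_ to _divℤ_)
  open import Data.Integer.Solver using (module +-*-Solver)
  open import Data.Nat using (suc)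
  open import Data.Rational using (ℚ; ↥_)
  import Data.Rational as ℚ
  open import Function using (_∘_)
  open import Relation.Nullary using (yes; no; contradiction)
  open import Relation.Binary.PropositionalEquality

  module _ {n} (G : SimpleGraph n) where

    degree₂ : Vec₂ n
    degree₂ i = mod2 (degree G i)

    degree₂≡adj·𝟙 : ∀ i → degree₂ i ≡ (adj G ·₂ 𝟙₂) i
    degree₂≡adj·𝟙 i = trans (mod2-sumℤ (boolℤ ∘ adj G i))
      (Σ₂.sum-cong-≗ (λ j → trans (mod2-boolℤ (adj G i j)) (sym (∧-identityʳ (adj G i j)))))

    handshake₂ : dot 𝟙₂ degree₂ ≡ false
    handshake₂ = begin
      dot 𝟙₂ degree₂            ≡⟨ dot-cong (λ _ → refl) degree₂≡adj·𝟙 ⟩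
      dot 𝟙₂ (adj G ·₂ 𝟙₂)      ≡⟨ dot-·₂-self (symmetric G) 𝟙₂ ⟩
      dot (λ i → adj G i i) 𝟙₂  ≡⟨ dot-comm (λ i → adj G i i) 𝟙₂ ⟩
      dot 𝟙₂ (λ i → adj G i i)  ≡⟨ dot-zeroʳ 𝟙₂ (loopless G) ⟩
      false                     ∎
      where open ≡-Reasoning

    degMat-diagonal : ∀ i → degMat G i i ≡ degree G i
    degMat-diagonal i with i ≟ i
    ... | yes _  = refl
    ... | no i≢i = contradiction refl i≢i

    degMat-symmetric : ∀ i j → degMat G i j ≡ degMat G j i
    degMat-symmetric i j with i ≟ j | j ≟ i
    ... | yes refl | yes _   = refl
    ... | yes i≡j  | no j≢i  = contradiction (sym i≡j) j≢i
    ... | no i≢j   | yes j≡i = contradiction (sym j≡i) i≢j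
    ... | no _     | no _    = refl

  module _ {n} (α : ℚ) (G : SimpleGraph n) where

    Acα-symmetric : ∀ i j → Acα α G i j ≡ Acα α G j i
    Acα-symmetric i j = cong₂ (λ D A → ↥ α ℤ.* D ℤ.+ (cα α ℤ.- ↥ α) ℤ.* A)
                              (degMat-symmetric G i j) (cong boolℤ (symmetric G i j))

    Acα·𝟏 : ∀ i → (Acα α G ·ᵥ 𝟏) i ≡ cα α ℤ.* degree G i
    Acα·𝟏 i = begin
      (Acα α G ·ᵥ 𝟏) i
        ≡⟨ ·ᵥ≡sum (Acα α G) 𝟏 i ⟩
      Σℤ.sum (λ j → Acα α G i j ℤ.* + 1)
        ≡⟨ Σℤ.sum-cong-≗ (λ j → ℤₚ.*-identityʳ (Acα α G i j)) ⟩
      Σℤ.sum (λ j → P ℤ.* degMat G i j ℤ.+ R ℤ.* adjMat G i j)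
        ≡⟨ Σℤ.∑-distrib-+ (λ j → P ℤ.* degMat G i j) (λ j → R ℤ.* adjMat G i j) ⟩
      Σℤ.sum (λ j → P ℤ.* degMat G i j) ℤ.+ Σℤ.sum (λ j → R ℤ.* adjMat G i j)
        ≡⟨ cong₂ ℤ._+_ (Σℤ.*-distribˡ-sum P (degMat G i)) (Σℤ.*-distribˡ-sum R (adjMat G i)) ⟨
      P ℤ.* Σℤ.sum (degMat G i) ℤ.+ R ℤ.* Σℤ.sum (adjMat G i)
        ≡⟨ cong₂ (λ a b → P ℤ.* a ℤ.+ R ℤ.* b)
                 (sum-if-≟ ℤₚ.+-0-monoid i (λ _ → degree G i)) (sym (sumℤ≡sum (adjMat G i))) ⟩
      P ℤ.* degree G i ℤ.+ R ℤ.* degree G i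
        ≡⟨ solve 3 (λ p c d → p :* d :+ (c :- p) :* d := c :* d) refl P (cα α) (degree G i) ⟩
      cα α ℤ.* degree G i ∎
      where
      open ≡-Reasoning
      open +-*-Solver
      P = ↥ α
      R = cα α ℤ.- ↥ α

    Acα₂ : Mat₂ n
    Acα₂ = reduce₂ (Acα α G)

    Acα₂-symmetric : IsSymmetric Acα₂
    Acα₂-symmetric i j = cong mod2 (Acα-symmetric i j)

    Acα₂-diagonal : ∀ i → Acα₂ i i ≡ mod2 (↥ α) ∧ degree₂ G i
    Acα₂-diagonal i = begin
      mod2 (↥ α ℤ.* degMat G i i ℤ.+ R ℤ.* adjMat G i i)
        ≡⟨ mod2-+ (↥ α ℤ.* degMat G i i) (R ℤ.* adjMat G i i) ⟩
      mod2 (↥ α ℤ.* degMat G i i) xor mod2 (R ℤ.* adjMat G i i)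
        ≡⟨ cong₂ _xor_ (mod2-* (↥ α) (degMat G i i)) (mod2-* R (adjMat G i i)) ⟩
      (mod2 (↥ α) ∧ mod2 (degMat G i i)) xor (mod2 R ∧ mod2 (adjMat G i i))
        ≡⟨ cong₂ (λ a b → (mod2 (↥ α) ∧ mod2 a) xor (mod2 R ∧ mod2 (boolℤ b)))
                 (degMat-diagonal G i) (loopless G i) ⟩
      (mod2 (↥ α) ∧ degree₂ G i) xor (mod2 R ∧ false)
        ≡⟨ cong ((mod2 (↥ α) ∧ degree₂ G i) xor_) (∧-zeroʳ (mod2 R)) ⟩
      (mod2 (↥ α) ∧ degree₂ G i) xor false
        ≡⟨ xor-identityʳ _ ⟩
      mod2 (↥ α) ∧ degree₂ G i ∎
      where
      open ≡-Reasoning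
      R = cα α ℤ.- ↥ α

    Acα₂·𝟙 : ∀ i → (Acα₂ ·₂ 𝟙₂) i ≡ mod2 (cα α) ∧ degree₂ G i
    Acα₂·𝟙 i =
      trans (sym (mod2-·ᵥ (Acα α G) 𝟏 i)) (trans (cong mod2 (Acα·𝟏 i)) (mod2-* (cα α) (degree G i)))

    column₂ : Fin n → Vec₂ n
    column₂ c i = mod2 (W̃ α G i c)

  module _ {n} (α : ℚ) (G : SimpleGraph (suc n)) where

    W̃-suc : ∀ k i → W̃ α G i (suc k) ≡ ((Acα α G ^ₘ toℕ k) ·ᵥ degree G) i
    W̃-suc k i = begin
      W̃ α G i (suc k)
        ≡⟨⟩
      ((M ^ₘ suc (toℕ k)) ·ᵥ 𝟏) i divℤ cα α
        ≡⟨ cong (_divℤ cα α) (^ₘ-suc-·ᵥ M (toℕ k) 𝟏 i) ⟩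
      ((M ^ₘ toℕ k) ·ᵥ (M ·ᵥ 𝟏)) i divℤ cα α
        ≡⟨ cong (_divℤ cα α) (·ᵥ-cong (M ^ₘ toℕ k) (Acα·𝟏 α G) i) ⟩
      ((M ^ₘ toℕ k) ·ᵥ (λ j → cα α ℤ.* degree G j)) i divℤ cα α
        ≡⟨ cong (_divℤ cα α) (·ᵥ-scale (M ^ₘ toℕ k) (cα α) (degree G) i) ⟩
      (cα α ℤ.* ((M ^ₘ toℕ k) ·ᵥ degree G) i) divℤ cα α
        ≡⟨ *-divℤ-cancelˡ (ℚ.ℚ.denominator-1 α) _ ⟩
      ((M ^ₘ toℕ k) ·ᵥ degree G) i ∎
      where
      open ≡-Reasoning
      M = Acα α G

    column₂-suc : ∀ k i → column₂ α G (suc k) i ≡ krylov (Acα₂ α G) (degree₂ G) (toℕ k) i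
    column₂-suc k i = trans (cong mod2 (W̃-suc k i)) (mod2-^ₘ-·ᵥ (Acα α G) (degree G) (toℕ k) i)

  module _ {n} (α : ℚ) (G : SimpleGraph n) where

    open KrylovIsotropy {d = degree₂ G} {γ = mod2 (cα α)} {p = mod2 (↥ α)}
      (Acα₂-symmetric α G) (Acα₂·𝟙 α G) (Acα₂-diagonal α G) (handshake₂ G)

    column₂-isotropic : ∀ c c′ → toℕ c ≢ 0 → dot (column₂ α G c) (column₂ α G c′) ≡ false
    column₂-isotropic zero    _        0≢0 = contradiction refl 0≢0
    column₂-isotropic (suc k) zero     _   = begin
      dot (column₂ α G (suc k)) 𝟙₂                    ≡⟨ dot-comm (column₂ α G (suc k)) 𝟙₂ ⟩
      dot 𝟙₂ (column₂ α G (suc k))                    ≡⟨ dot-cong {x = 𝟙₂} (λ _ → refl) (column₂-suc α G k) ⟩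
      dot 𝟙₂ (krylov (Acα₂ α G) (degree₂ G) (toℕ k))  ≡⟨ dot-𝟙-krylov≡0 (toℕ k) ⟩
      false                                           ∎
      where open ≡-Reasoning
    column₂-isotropic (suc k) (suc k′) _ =
      trans (dot-cong (column₂-suc α G k) (column₂-suc α G k′)) (dot-krylov≡0 (toℕ k) (toℕ k′))

open import Data.Nat using (ℕ; ⌈_/2⌉)
open import Data.Rational using (ℚ; 0ℚ; 1ℚ; _≤_; _<_)
open LinearAlgebraOver𝔽₂ using (independent-selection-≤; linIndepF2⇒independent)
open WalkMatrix using (column₂; column₂-isotropic)

lemma3p7 : (n : ℕ) (G : SimpleGraph n) → Connected G →
    (α : ℚ) → 0ℚ ≤ α → α < 1ℚ →
    RankF2≤ (W̃ α G) ⌈ n /2⌉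
lemma3p7 n G _ α _ _ m s independent =
  independent-selection-≤ (column₂ α G) (column₂-isotropic α G) s (linIndepF2⇒independent independent)
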